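{- For every integer $r\geq 3$ and every positive integer $n$, every collection of $n$ matchings, each of size $\lceil \frac{(r+1)n}{2}\rceil$, in an $r$-uniform hypergraph contains a rainbow matching of size at least $n-2^r\sqrt{n}$.
   Context: A hypergraph is $r$-uniform if every edge has exactly $r$ vertices. A matching is a set of pairwise vertex-disjoint edges. Given a collection of matchings $M_1,\dots,M_n$ in a hypergraph (not necessarily disjoint from each other), a matching $M\subseteq \bigcup_{i=1}^n M_i$ is rainbow if there is an injection $\phi: M\to[n]$ such that every edge $e\in M$ belongs to $M_{\phi(e)}$. -}

module Defs where

open import Data.Nat using (ℕ; _+_; _*_; _/_; _≡ᵇ_)
open import Data.Fin using (Fin)
open import Data.Fin.Subset using (Subset; _∩_; ∣_∣; Empty)
open import Data.List using (List; length; lookup)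
open import Data.List.Membership.Propositional using (_∈_)
open import Data.List.Relation.Unary.All using (All)
open import Data.List.Relation.Unary.AllPairs using (AllPairs)
open import Data.Product using (Σ; _×_)
open import Function.Definitions using (Injective)
open import Relation.Binary.PropositionalEquality using (_≡_)

Edge : ℕ → Set
Edge N = Subset N

Disjoint : ∀ {N} → Edge N → Edge N → Set
Disjoint e f = Empty (e ∩ f)

IsMatching : ∀ {N} → ℕ → List (Edge N) → Set
IsMatching r M = All (λ e → ∣ e ∣ ≡ r) M × AllPairs Disjoint M

⌈_/2⌉ : ℕ → ℕ
⌈ a /2⌉ = (a + 1) / 2

IsRainbow : ∀ {N n} → (Fin n → List (Edge N)) → List (Edge N) → Set
IsRainbow {n = n} Ms M =
  Σ (Fin (length M) → Fin n) λ φ →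
    Injective _≡_ _≡_ φ × (∀ i → lookup M i ∈ Ms (φ i))

{-# OPTIONS --safe #-}
module Submission where

-- Grow a rainbow matching R greedily: either add an edge of an unused colour that avoids R, or
-- exchange an edge e of R for two disjoint edges of distinct unused colours that avoid R - e.
-- Suppose neither move is possible, and let k be the number of unused colours, m = |R|, so that
-- n ≤ k + m.  Every edge of an unused colour meets R, and the r-sets of R are met at most r m
-- times by a matching, so counting twice the edges that meet R only once (the pendant edges)
-- gives at least k ((r + 1) n - r m) pendant edges of unused colours.  Conversely, for a fixed
-- e ∈ R, the unused colours with two pendant edges A_c, B_c at e form a cross-intersecting family
-- of pairs of r-sets (otherwise e could be exchanged), so by Bollobás's theorem there are at most
-- C(2r, r) ≤ 4^r of them, while each colour has at most r pendant edges at e.  Hence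
-- k (r + 1) (n - m) ≤ (r - 1) m 4^r, and with n - m ≤ k this gives (n - m)² ≤ 4^r n.

open import Defs
open import Data.Bool using (Bool; true; false; not; _∧_; if_then_else_)
import Data.Bool as Bool
open import Data.Bool.ListAction using (all)
open import Data.Bool.Properties using (∧-zeroʳ; ¬-not)
open import Data.Empty using (⊥-elim)
open import Data.Fin using (Fin; zero; suc)
open import Data.Fin.Properties using (_≟_)
import Data.Fin.Properties as Fin
open import Data.Fin.Subset using (Subset; _─_; ∣_∣; Nonempty; _∩_)
open import Data.Fin.Subset.Properties using (p∩q≢∅⇒∣p─q∣<∣p∣)
open import Data.List using (List; []; _∷_; length; map; filter)
import Data.List as List
open import Data.List.Membership.Propositional using (_∈_; find; lose)
open import Data.List.Membership.Propositional.Properties using (∈-filter⁻; ∈-map⁻)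
open import Data.List.Properties using (length-map)
open import Data.List.Relation.Unary.All using (All; []; _∷_)
import Data.List.Relation.Unary.All as All
import Data.List.Relation.Unary.All.Properties as All
open import Data.List.Relation.Unary.AllPairs using (AllPairs; []; _∷_)
import Data.List.Relation.Unary.AllPairs as AllPairs
import Data.List.Relation.Unary.AllPairs.Properties as AllPairs
open import Data.List.Relation.Unary.Any using (Any; here; there)
import Data.List.Relation.Unary.Any as Any
open import Data.Maybe using (Maybe; just; nothing; is-just)
open import Data.Nat using (ℕ; zero; suc; pred; _+_; _*_; _∸_; _^_; _≤_; _≥_; z≤n; s≤s; _!; _≤?_; _≡ᵇ_; _/_; >-nonZero)
open import Data.Nat.DivMod using (_%_; m≡m%n+[m/n]*n; m%n<n)
open import Data.Nat.Properties
  using ( +-0-monoid; +-commutativeSemigroup; module ≤-Reasoning; _!≢0; _!*_!≢0; suc-injective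
        ; +-assoc; +-comm; +-suc; +-identityʳ; +-cancelʳ-≡
        ; *-assoc; *-comm; *-identityˡ; *-identityʳ; *-zeroʳ; *-distribˡ-+; *-distribʳ-+
        ; ≤-refl; ≤-reflexive; ≤-trans; ≤-pred; <⇒≤; ≰⇒>; n≤1+n; m≤n⇒m≤1+n; m≤m+n; m≤n+m; n<1⇒n≡0
        ; +-mono-≤; +-monoˡ-≤; +-monoʳ-≤; +-cancelˡ-≤; +-cancelʳ-≤
        ; *-mono-≤; *-monoˡ-≤; *-monoʳ-≤; *-cancelˡ-≤; *-cancelʳ-≤
        ; m∸n+n≡m; m+[n∸m]≡n; m∸n≤m; m≤n⇒m∸n≡0; m≤n⇒∃[o]m+o≡n; pred[m∸n]≡m∸[1+n] )
open import Algebra.Properties.CommutativeSemigroup +-commutativeSemigroup using () renaming (interchange to +-interchange)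
open import Algebra.Properties.Monoid.Sum +-0-monoid using (sum; sum-syntax; sum-cong-≗)
open import Data.Nat.Tactic.RingSolver using (solve-∀)
open import Data.Product using (Σ; _×_; _,_; proj₁; proj₂)
open import Data.Sum using (_⊎_; inj₁; inj₂)
open import Data.Vec using ([]; _∷_; lookup; removeAt)
import Data.Vec as Vec
open import Function using (_∘_)
open import Function.Definitions using (Injective)
open import Relation.Binary.PropositionalEquality using (_≡_; _≢_; refl; sym; trans; cong; cong₂; subst; module ≡-Reasoning)
open import Relation.Nullary using (Dec; yes; no; does; ¬_; ¬?; _×-dec_)

private variable
  A B : Set
  k : ℕ
  xs : List A

bit : Bool → ℕ
bit true = 1
bit false = 0

∧≡true : ∀ {a b} → a ∧ b ≡ true → a ≡ true × b ≡ true
∧≡true {true} b≡true = refl , b≡true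

bit-∧≤ : ∀ a b → bit (a ∧ b) ≤ bit a
bit-∧≤ true true = ≤-refl
bit-∧≤ true false = z≤n
bit-∧≤ false b = z≤n

∑ˡ : (A → ℕ) → List A → ℕ
∑ˡ f [] = 0
∑ˡ f (x ∷ xs) = f x + ∑ˡ f xs

infixl 10 ∑ˡ
syntax ∑ˡ (λ x → e) xs = ∑[ x ∈ xs ] e

module _ {f g : A → ℕ} where

  ∑ˡ-cong : ∀ {xs} → All (λ x → f x ≡ g x) xs → ∑ˡ f xs ≡ ∑ˡ g xs
  ∑ˡ-cong [] = refl
  ∑ˡ-cong (p ∷ ps) = cong₂ _+_ p (∑ˡ-cong ps)

  ∑ˡ-mono-≤ : ∀ {xs} → All (λ x → f x ≤ g x) xs → ∑ˡ f xs ≤ ∑ˡ g xs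
  ∑ˡ-mono-≤ [] = z≤n
  ∑ˡ-mono-≤ (p ∷ ps) = +-mono-≤ p (∑ˡ-mono-≤ ps)

  ∑ˡ-distrib-+ : ∀ xs → ∑[ x ∈ xs ] (f x + g x) ≡ ∑ˡ f xs + ∑ˡ g xs
  ∑ˡ-distrib-+ [] = refl
  ∑ˡ-distrib-+ (x ∷ xs) rewrite ∑ˡ-distrib-+ xs = +-interchange (f x) (g x) (∑ˡ f xs) (∑ˡ g xs)

∑ˡ-const : ∀ c (xs : List A) → ∑[ x ∈ xs ] c ≡ length xs * c
∑ˡ-const c [] = refl
∑ˡ-const c (x ∷ xs) = cong (c +_) (∑ˡ-const c xs)

∑ˡ-*ˡ : ∀ c (f : A → ℕ) xs → ∑[ x ∈ xs ] (c * f x) ≡ c * ∑ˡ f xs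
∑ˡ-*ˡ c f [] = sym (*-zeroʳ c)
∑ˡ-*ˡ c f (x ∷ xs) rewrite ∑ˡ-*ˡ c f xs = sym (*-distribˡ-+ c (f x) (∑ˡ f xs))

∑ˡ-map : ∀ (f : B → ℕ) (h : A → B) xs → ∑ˡ f (map h xs) ≡ ∑ˡ (f ∘ h) xs
∑ˡ-map f h [] = refl
∑ˡ-map f h (x ∷ xs) = cong (f (h x) +_) (∑ˡ-map f h xs)

∑ˡ-comm : ∀ (h : A → B → ℕ) xs ys → ∑[ x ∈ xs ] ∑ˡ (h x) ys ≡ ∑[ y ∈ ys ] ∑[ x ∈ xs ] h x y
∑ˡ-comm h [] ys = sym (trans (∑ˡ-const 0 ys) (*-zeroʳ (length ys)))
∑ˡ-comm h (x ∷ xs) ys rewrite ∑ˡ-comm h xs ys = sym (∑ˡ-distrib-+ ys)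

∑-mono-≤ : ∀ {n} {f g : Fin n → ℕ} → (∀ i → f i ≤ g i) → sum f ≤ sum g
∑-mono-≤ {zero} h = z≤n
∑-mono-≤ {suc n} h = +-mono-≤ (h zero) (∑-mono-≤ (h ∘ suc))

∑-const : ∀ n c → ∑[ i < n ] c ≡ n * c
∑-const zero c = refl
∑-const (suc n) c = cong (c +_) (∑-const n c)

∑-distrib-+ : ∀ {n} (f g : Fin n → ℕ) → ∑[ i < n ] (f i + g i) ≡ sum f + sum g
∑-distrib-+ {zero} f g = refl
∑-distrib-+ {suc n} f g rewrite ∑-distrib-+ (f ∘ suc) (g ∘ suc) = +-interchange (f zero) (g zero) _ _

∑-*ˡ : ∀ {n} c (f : Fin n → ℕ) → ∑[ i < n ] (c * f i) ≡ c * sum f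
∑-*ˡ {zero} c f = sym (*-zeroʳ c)
∑-*ˡ {suc n} c f rewrite ∑-*ˡ c (f ∘ suc) = sym (*-distribˡ-+ c (f zero) _)

∑-*ʳ : ∀ {n} c (f : Fin n → ℕ) → ∑[ i < n ] (f i * c) ≡ sum f * c
∑-*ʳ {zero} c f = refl
∑-*ʳ {suc n} c f rewrite ∑-*ʳ c (f ∘ suc) = sym (*-distribʳ-+ c (f zero) _)

∑-∑ˡ-comm : ∀ {n} (h : Fin n → A → ℕ) xs → ∑[ i < n ] ∑ˡ (h i) xs ≡ ∑[ x ∈ xs ] ∑[ i < n ] h i x
∑-∑ˡ-comm {n = zero} h xs = sym (trans (∑ˡ-const 0 xs) (*-zeroʳ (length xs)))
∑-∑ˡ-comm {n = suc n} h xs rewrite ∑-∑ˡ-comm (h ∘ suc) xs = sym (∑ˡ-distrib-+ xs)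

disjointᵇ : Subset k → Subset k → Bool
disjointᵇ [] [] = true
disjointᵇ (a ∷ e) (b ∷ f) = not (a ∧ b) ∧ disjointᵇ e f

meetsᵇ : Subset k → Subset k → Bool
meetsᵇ e f = not (disjointᵇ e f)

disjointᵇ-comm : ∀ (e f : Subset k) → disjointᵇ e f ≡ disjointᵇ f e
disjointᵇ-comm [] [] = refl
disjointᵇ-comm (true ∷ e) (true ∷ f) = refl
disjointᵇ-comm (true ∷ e) (false ∷ f) = disjointᵇ-comm e f
disjointᵇ-comm (false ∷ e) (true ∷ f) = disjointᵇ-comm e f
disjointᵇ-comm (false ∷ e) (false ∷ f) = disjointᵇ-comm e f

disjointᵇ⇒Disjoint : ∀ (e f : Subset k) → disjointᵇ e f ≡ true → Disjoint e f
disjointᵇ⇒Disjoint (true ∷ e) (true ∷ f) () _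
disjointᵇ⇒Disjoint (true ∷ e) (false ∷ f) h (suc x , Vec.there x∈) = disjointᵇ⇒Disjoint e f h (x , x∈)
disjointᵇ⇒Disjoint (false ∷ e) (true ∷ f) h (suc x , Vec.there x∈) = disjointᵇ⇒Disjoint e f h (x , x∈)
disjointᵇ⇒Disjoint (false ∷ e) (false ∷ f) h (suc x , Vec.there x∈) = disjointᵇ⇒Disjoint e f h (x , x∈)

Disjoint⇒disjointᵇ : ∀ (e f : Subset k) → Disjoint e f → disjointᵇ e f ≡ true
Disjoint⇒disjointᵇ [] [] _ = refl
Disjoint⇒disjointᵇ (true ∷ e) (true ∷ f) e#f = ⊥-elim (e#f (zero , Vec.here))
Disjoint⇒disjointᵇ (true ∷ e) (false ∷ f) e#f = Disjoint⇒disjointᵇ e f (λ (x , x∈) → e#f (suc x , Vec.there x∈))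
Disjoint⇒disjointᵇ (false ∷ e) (true ∷ f) e#f = Disjoint⇒disjointᵇ e f (λ (x , x∈) → e#f (suc x , Vec.there x∈))
Disjoint⇒disjointᵇ (false ∷ e) (false ∷ f) e#f = Disjoint⇒disjointᵇ e f (λ (x , x∈) → e#f (suc x , Vec.there x∈))

meetsᵇ⇒Nonempty : ∀ (e f : Subset k) → disjointᵇ e f ≡ false → Nonempty (e ∩ f)
meetsᵇ⇒Nonempty [] [] ()
meetsᵇ⇒Nonempty (true ∷ e) (true ∷ f) _ = zero , Vec.here
meetsᵇ⇒Nonempty (true ∷ e) (false ∷ f) h = let x , x∈ = meetsᵇ⇒Nonempty e f h in suc x , Vec.there x∈
meetsᵇ⇒Nonempty (false ∷ e) (true ∷ f) h = let x , x∈ = meetsᵇ⇒Nonempty e f h in suc x , Vec.there x∈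
meetsᵇ⇒Nonempty (false ∷ e) (false ∷ f) h = let x , x∈ = meetsᵇ⇒Nonempty e f h in suc x , Vec.there x∈

disjointᵇ-─ : ∀ (h g f : Subset k) → disjointᵇ h g ≡ true → disjointᵇ h (f ─ g) ≡ disjointᵇ h f
disjointᵇ-─ [] [] [] _ = refl
disjointᵇ-─ (true ∷ h) (true ∷ g) (a ∷ f) ()
disjointᵇ-─ (true ∷ h) (false ∷ g) (true ∷ f) _ = refl
disjointᵇ-─ (true ∷ h) (false ∷ g) (false ∷ f) h#g = disjointᵇ-─ h g f h#g
disjointᵇ-─ (false ∷ h) (b ∷ g) (a ∷ f) h#g = disjointᵇ-─ h g f h#g

-- Each member meeting f uses up a point of f that no later member can meet.
∑-meetsᵇ≤∣∣ : ∀ (f : Subset k) {L} → AllPairs (λ g h → disjointᵇ g h ≡ true) L → ∑[ g ∈ L ] bit (meetsᵇ g f) ≤ ∣ f ∣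
∑-meetsᵇ≤∣∣ f [] = z≤n
∑-meetsᵇ≤∣∣ f {g ∷ L} (g#L ∷ L-disjoint) with disjointᵇ g f in g#f
... | true = ∑-meetsᵇ≤∣∣ f L-disjoint
... | false = begin-strict
  ∑[ h ∈ L ] bit (meetsᵇ h f)        ≡⟨ ∑ˡ-cong (All.map meets-unchanged g#L) ⟨
  ∑[ h ∈ L ] bit (meetsᵇ h (f ─ g))  ≤⟨ ∑-meetsᵇ≤∣∣ (f ─ g) L-disjoint ⟩
  ∣ f ─ g ∣                          <⟨ p∩q≢∅⇒∣p─q∣<∣p∣ f g (meetsᵇ⇒Nonempty f g (trans (disjointᵇ-comm f g) g#f)) ⟩
  ∣ f ∣                              ∎
  where
  open ≤-Reasoning
  meets-unchanged : ∀ {h} → disjointᵇ g h ≡ true → bit (meetsᵇ h (f ─ g)) ≡ bit (meetsᵇ h f)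
  meets-unchanged {h} g#h = cong (bit ∘ not) (disjointᵇ-─ h g f (trans (disjointᵇ-comm h g) g#h))

∣∣-removeAt : ∀ (v : Subset (suc k)) x → ∣ v ∣ ≡ bit (lookup v x) + ∣ removeAt v x ∣
∣∣-removeAt (true ∷ v) zero = refl
∣∣-removeAt (false ∷ v) zero = refl
∣∣-removeAt (true ∷ v@(_ ∷ _)) (suc x) = trans (cong suc (∣∣-removeAt v x)) (sym (+-suc _ _))
∣∣-removeAt (false ∷ v@(_ ∷ _)) (suc x) = ∣∣-removeAt v x

disjointᵇ-removeAt : ∀ (A B : Subset (suc k)) x → lookup A x ≡ false →
                     disjointᵇ (removeAt A x) (removeAt B x) ≡ disjointᵇ A B
disjointᵇ-removeAt (false ∷ A) (b ∷ B) zero _ = refl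
disjointᵇ-removeAt (a ∷ A@(_ ∷ _)) (b ∷ B@(_ ∷ _)) (suc x) x∉A = cong (not (a ∧ b) ∧_) (disjointᵇ-removeAt A B x x∉A)

disjointᵇ⇒∣∣+∣∣≤ : ∀ (A B : Subset k) → disjointᵇ A B ≡ true → ∣ A ∣ + ∣ B ∣ ≤ k
disjointᵇ⇒∣∣+∣∣≤ [] [] _ = z≤n
disjointᵇ⇒∣∣+∣∣≤ (true ∷ A) (false ∷ B) A#B = s≤s (disjointᵇ⇒∣∣+∣∣≤ A B A#B)
disjointᵇ⇒∣∣+∣∣≤ (false ∷ A) (true ∷ B) A#B rewrite +-suc ∣ A ∣ ∣ B ∣ = s≤s (disjointᵇ⇒∣∣+∣∣≤ A B A#B)
disjointᵇ⇒∣∣+∣∣≤ (false ∷ A) (false ∷ B) A#B = m≤n⇒m≤1+n (disjointᵇ⇒∣∣+∣∣≤ A B A#B)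

meetsᵇ⇒∣∣≥1 : ∀ (A B : Subset k) → disjointᵇ A B ≡ false → 1 ≤ ∣ B ∣
meetsᵇ⇒∣∣≥1 [] [] ()
meetsᵇ⇒∣∣≥1 (a ∷ A) (true ∷ B) _ = s≤s z≤n
meetsᵇ⇒∣∣≥1 (true ∷ A) (false ∷ B) A∩B = meetsᵇ⇒∣∣≥1 A B A∩B
meetsᵇ⇒∣∣≥1 (false ∷ A) (false ∷ B) A∩B = meetsᵇ⇒∣∣≥1 A B A∩B

-- Bollobás's two-families theorem

-- beforeCount N a b is the number of orderings of N points in which a fixed a-set entirely
-- precedes a fixed disjoint b-set (split on the last point, which lies outside the a-set);
-- beforeCount-closed identifies it with N! a! b! / (a + b)!.
beforeCount : ℕ → ℕ → ℕ → ℕ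
beforeCount N a zero = N !
beforeCount zero a (suc b) = 0
beforeCount (suc N) a (suc b) = (N ∸ (a + b)) * beforeCount N a (suc b) + suc b * beforeCount N a b

beforeCount-closed : ∀ N a b → a + b ≤ N → beforeCount N a b * (a + b) ! ≡ N ! * a ! * b !
beforeCount-closed N a zero _ rewrite +-identityʳ a = sym (*-identityʳ _)
beforeCount-closed zero a (suc b) a+1+b≤0 rewrite +-suc a b with () ← a+1+b≤0
beforeCount-closed (suc N) a (suc b) a+1+b≤1+N = begin
  (d * X + suc b * Y) * (a + suc b) !
    ≡⟨ *-distribʳ-+ ((a + suc b) !) (d * X) (suc b * Y) ⟩
  d * X * (a + suc b) ! + suc b * Y * (a + suc b) !
    ≡⟨ cong₂ _+_ (*-assoc d X _) (cong (λ u → suc b * Y * u !) (+-suc a b)) ⟩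
  d * (X * (a + suc b) !) + suc b * Y * (suc (a + b) * (a + b) !)
    ≡⟨ cong (d * (X * (a + suc b) !) +_) (rearrange (suc b) Y (suc (a + b)) ((a + b) !)) ⟩
  d * (X * (a + suc b) !) + suc (a + b) * (suc b * (Y * (a + b) !))
    ≡⟨ cong₂ (λ u v → u + suc (a + b) * (suc b * v)) first-term (beforeCount-closed N a b a+b≤N) ⟩
  d * (N ! * a ! * (suc b * b !)) + suc (a + b) * (suc b * (N ! * a ! * b !))
    ≡⟨ collect d (N !) (a !) (suc b) (b !) (suc (a + b)) ⟩
  (d + suc (a + b)) * N ! * a ! * (suc b * b !)
    ≡⟨ cong (λ u → u * N ! * a ! * (suc b * b !)) (trans (+-suc d (a + b)) (cong suc (m∸n+n≡m a+b≤N))) ⟩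
  suc N * N ! * a ! * (suc b * b !) ∎
  where
  open ≡-Reasoning
  d X Y : ℕ
  d = N ∸ (a + b)
  X = beforeCount N a (suc b)
  Y = beforeCount N a b
  a+b≤N : a + b ≤ N
  a+b≤N = ≤-pred (subst (_≤ suc N) (+-suc a b) a+1+b≤1+N)
  -- Truncated subtraction makes d = 0 exactly when the induction hypothesis is unavailable.
  first-term : d * (X * (a + suc b) !) ≡ d * (N ! * a ! * (suc b * b !))
  first-term with a + suc b ≤? N
  ... | yes a+1+b≤N = cong (d *_) (beforeCount-closed N a (suc b) a+1+b≤N)
  ... | no a+1+b≰N rewrite m≤n⇒m∸n≡0 (≤-pred (subst (suc N ≤_) (+-suc a b) (≰⇒> a+1+b≰N))) = refl
  rearrange : ∀ s Y t f → s * Y * (t * f) ≡ t * (s * (Y * f))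
  rearrange = solve-∀
  collect : ∀ d n a s b t → d * (n * a * (s * b)) + t * (s * (n * a * b)) ≡ (d + t) * n * a * (s * b)
  collect = solve-∀

SetPair : ℕ → Set
SetPair k = Subset k × Subset k

DisjointPairs : List (SetPair k) → Set
DisjointPairs = All λ p → disjointᵇ (proj₁ p) (proj₂ p) ≡ true

CrossIntersecting : List (SetPair k) → Set
CrossIntersecting = AllPairs λ p q → disjointᵇ (proj₁ p) (proj₂ q) ≡ false × disjointᵇ (proj₁ q) (proj₂ p) ≡ false

weight : SetPair k → ℕ
weight {k} (A , B) = beforeCount k ∣ A ∣ ∣ B ∣

restrict : Fin (suc k) → SetPair (suc k) → SetPair k
restrict x (A , B) = removeAt A x , removeAt B x

weightEndingAt : Fin (suc k) → SetPair (suc k) → ℕ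
weightEndingAt x (A , B) = if lookup A x then 0 else weight (restrict x (A , B))

lastPointWeight : ℕ → ℕ → Bool → Bool → ℕ
lastPointWeight c₀ c₁ a b = if a then 0 else if b then c₁ else c₀

-- Stated with (∣ A ∣ + ∣ B ∣) * c₀ on the left, so that no subtraction occurs.
∑-lastPointWeight : ∀ (A B : Subset k) c₀ c₁ → disjointᵇ A B ≡ true →
  ∑[ x < k ] lastPointWeight c₀ c₁ (lookup A x) (lookup B x) + (∣ A ∣ + ∣ B ∣) * c₀ ≡ k * c₀ + ∣ B ∣ * c₁
∑-lastPointWeight [] [] c₀ c₁ _ = refl
∑-lastPointWeight {suc k} (true ∷ A) (false ∷ B) c₀ c₁ A#B =
  trans (point-in-A _ ∣ A ∣ ∣ B ∣ c₀) (trans (cong (c₀ +_) (∑-lastPointWeight A B c₀ c₁ A#B)) (sym (+-assoc c₀ _ _)))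
  where point-in-A : ∀ S a b c₀ → S + (suc a + b) * c₀ ≡ c₀ + (S + (a + b) * c₀)
        point-in-A = solve-∀
∑-lastPointWeight {suc k} (false ∷ A) (true ∷ B) c₀ c₁ A#B =
  trans (point-in-B _ ∣ A ∣ ∣ B ∣ c₀ c₁) (trans (cong (c₀ + c₁ +_) (∑-lastPointWeight A B c₀ c₁ A#B)) (+-interchange c₀ c₁ _ _))
  where point-in-B : ∀ S a b c₀ c₁ → c₁ + S + (a + suc b) * c₀ ≡ c₀ + c₁ + (S + (a + b) * c₀)
        point-in-B = solve-∀
∑-lastPointWeight {suc k} (false ∷ A) (false ∷ B) c₀ c₁ A#B =
  trans (+-assoc c₀ _ _) (trans (cong (c₀ +_) (∑-lastPointWeight A B c₀ c₁ A#B)) (sym (+-assoc c₀ _ _)))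

∑-weightEndingAt : ∀ {N b} (A B : Subset (suc N)) → disjointᵇ A B ≡ true → ∣ B ∣ ≡ suc b →
                   ∑[ x < suc N ] weightEndingAt x (A , B) ≡ weight (A , B)
∑-weightEndingAt {N} {b} A B A#B ∣B∣≡ = +-cancelʳ-≡ _ _ _ (begin
  ∑[ x < suc N ] weightEndingAt x (A , B) + (a + ∣ B ∣) * c₀
    ≡⟨ cong (_+ (a + ∣ B ∣) * c₀) (sum-cong-≗ ending-at) ⟩
  ∑[ x < suc N ] lastPointWeight c₀ c₁ (lookup A x) (lookup B x) + (a + ∣ B ∣) * c₀
    ≡⟨ ∑-lastPointWeight A B c₀ c₁ A#B ⟩
  suc N * c₀ + ∣ B ∣ * c₁
    ≡⟨ cong₂ (λ s t → s * c₀ + t * c₁) split-N ∣B∣≡ ⟩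
  (N ∸ (a + b) + (a + suc b)) * c₀ + suc b * c₁
    ≡⟨ regroup (N ∸ (a + b)) (a + suc b) c₀ (suc b * c₁) ⟩
  (N ∸ (a + b)) * c₀ + suc b * c₁ + (a + suc b) * c₀
    ≡⟨ cong₂ (λ w t → w + (a + t) * c₀) (cong (beforeCount (suc N) a) ∣B∣≡) ∣B∣≡ ⟨
  weight (A , B) + (a + ∣ B ∣) * c₀ ∎)
  where
  open ≡-Reasoning
  a c₀ c₁ : ℕ
  a = ∣ A ∣
  c₀ = beforeCount N a (suc b)
  c₁ = beforeCount N a b
  size-removeAt : ∀ (v : Subset (suc N)) x {c} → lookup v x ≡ c → ∣ v ∣ ≡ bit c + ∣ removeAt v x ∣
  size-removeAt v x refl = ∣∣-removeAt v x
  ending-at : ∀ x → weightEndingAt x (A , B) ≡ lastPointWeight c₀ c₁ (lookup A x) (lookup B x)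
  ending-at x with lookup A x in x∈A | lookup B x in x∈B
  ... | true | _ = refl
  ... | false | false = cong₂ (beforeCount N) (sym (size-removeAt A x x∈A)) (trans (sym (size-removeAt B x x∈B)) ∣B∣≡)
  ... | false | true = cong₂ (beforeCount N) (sym (size-removeAt A x x∈A)) (suc-injective (trans (sym (size-removeAt B x x∈B)) ∣B∣≡))
  split-N : suc N ≡ N ∸ (a + b) + (a + suc b)
  split-N = begin
    suc N                        ≡⟨ cong suc (m∸n+n≡m a+b≤N) ⟨
    suc (N ∸ (a + b) + (a + b))  ≡⟨ +-suc _ _ ⟨
    N ∸ (a + b) + suc (a + b)    ≡⟨ cong (N ∸ (a + b) +_) (+-suc a b) ⟨
    N ∸ (a + b) + (a + suc b)    ∎
    where
    a+b≤N : a + b ≤ N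
    a+b≤N = ≤-pred (subst (_≤ suc N) (trans (cong (a +_) ∣B∣≡) (+-suc a b)) (disjointᵇ⇒∣∣+∣∣≤ A B A#B))
  regroup : ∀ d e c t → (d + e) * c + t ≡ d * c + t + e * c
  regroup = solve-∀

restrictAll : Fin (suc k) → List (SetPair (suc k)) → List (SetPair k)
restrictAll x [] = []
restrictAll x (p ∷ Ps) with lookup (proj₁ p) x
... | true = restrictAll x Ps
... | false = restrict x p ∷ restrictAll x Ps

∑-weight-restrictAll : ∀ x (Ps : List (SetPair (suc k))) → ∑ˡ weight (restrictAll x Ps) ≡ ∑[ p ∈ Ps ] weightEndingAt x p
∑-weight-restrictAll x [] = refl
∑-weight-restrictAll x (p ∷ Ps) with lookup (proj₁ p) x
... | true = ∑-weight-restrictAll x Ps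
... | false = cong (weight (restrict x p) +_) (∑-weight-restrictAll x Ps)

All-restrictAll : ∀ {P : SetPair (suc k) → Set} {Q : SetPair k → Set} x →
                  (∀ {p} → lookup (proj₁ p) x ≡ false → P p → Q (restrict x p)) →
                  ∀ {Ps} → All P Ps → All Q (restrictAll x Ps)
All-restrictAll x f [] = []
All-restrictAll x f {p ∷ Ps} (Pp ∷ PPs) with lookup (proj₁ p) x in x∉p
... | true = All-restrictAll x f PPs
... | false = f x∉p Pp ∷ All-restrictAll x f PPs

DisjointPairs-restrictAll : ∀ x {Ps : List (SetPair (suc k))} → DisjointPairs Ps → DisjointPairs (restrictAll x Ps)
DisjointPairs-restrictAll x = All-restrictAll x λ {p} x∉p p-disjoint → trans (disjointᵇ-removeAt (proj₁ p) (proj₂ p) x x∉p) p-disjoint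

CrossIntersecting-restrictAll : ∀ x {Ps : List (SetPair (suc k))} → CrossIntersecting Ps → CrossIntersecting (restrictAll x Ps)
CrossIntersecting-restrictAll x [] = []
CrossIntersecting-restrictAll x {p ∷ Ps} (p×Ps ∷ Ps-cross) with lookup (proj₁ p) x in x∉p
... | true = CrossIntersecting-restrictAll x Ps-cross
... | false = All-restrictAll x (λ {q} x∉q (p×q , q×p) → trans (disjointᵇ-removeAt (proj₁ p) (proj₂ q) x x∉p) p×q ,
                                                       trans (disjointᵇ-removeAt (proj₁ q) (proj₂ p) x x∉q) q×p) p×Ps
              ∷ CrossIntersecting-restrictAll x Ps-cross

-- LYM form: for a cross-intersecting family no ordering has A before B for two of its pairs
-- (A , B), so the weights add up to at most N!; the proof counts orderings by their last point.
mutual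
  bollobás : ∀ N (Ps : List (SetPair N)) → DisjointPairs Ps → CrossIntersecting Ps → ∑ˡ weight Ps ≤ N !
  bollobás N [] _ _ = z≤n
  bollobás N (p ∷ []) disjoint cross with 1 ≤? ∣ proj₂ p ∣
  ... | yes 1≤∣B∣ = bollobás-nonempty N (p ∷ []) disjoint cross (1≤∣B∣ ∷ [])
  ... | no 1≰∣B∣ rewrite n<1⇒n≡0 (≰⇒> 1≰∣B∣) = ≤-reflexive (+-identityʳ (N !))
  bollobás N (p ∷ q ∷ Ps) disjoint cross@((p×q ∷ p×Ps) ∷ _) =
    bollobás-nonempty N (p ∷ q ∷ Ps) disjoint cross
      (meetsᵇ⇒∣∣≥1 (proj₁ q) (proj₂ p) (proj₂ p×q) ∷ All.map (λ p×r → meetsᵇ⇒∣∣≥1 (proj₁ p) _ (proj₁ p×r)) (p×q ∷ p×Ps))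

  bollobás-nonempty : ∀ N (Ps : List (SetPair N)) → DisjointPairs Ps → CrossIntersecting Ps →
                      All (λ p → 1 ≤ ∣ proj₂ p ∣) Ps → ∑ˡ weight Ps ≤ N !
  bollobás-nonempty zero [] _ _ _ = z≤n
  bollobás-nonempty zero ((_ , []) ∷ _) _ _ (() ∷ _)
  bollobás-nonempty (suc N) Ps disjoint cross nonempty = begin
    ∑ˡ weight Ps                                   ≡⟨ ∑ˡ-cong (All.zipWith (λ {p} → by-last-point {p}) (disjoint , nonempty)) ⟨
    ∑[ p ∈ Ps ] ∑[ x < suc N ] weightEndingAt x p  ≡⟨ ∑-∑ˡ-comm weightEndingAt Ps ⟨
    ∑[ x < suc N ] ∑[ p ∈ Ps ] weightEndingAt x p  ≡⟨ sum-cong-≗ (λ x → ∑-weight-restrictAll x Ps) ⟨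
    ∑[ x < suc N ] ∑ˡ weight (restrictAll x Ps)    ≤⟨ ∑-mono-≤ without-last-point ⟩
    ∑[ x < suc N ] (N !)                           ≡⟨ ∑-const (suc N) (N !) ⟩
    suc N * N !                                    ∎
    where
    open ≤-Reasoning
    by-last-point : ∀ {p} → disjointᵇ (proj₁ p) (proj₂ p) ≡ true × 1 ≤ ∣ proj₂ p ∣ → ∑[ x < suc N ] weightEndingAt x p ≡ weight p
    by-last-point {A , B} (A#B , 1≤∣B∣) = let b , 1+b≡∣B∣ = m≤n⇒∃[o]m+o≡n 1≤∣B∣ in ∑-weightEndingAt A B A#B (sym 1+b≡∣B∣)
    without-last-point : ∀ x → ∑ˡ weight (restrictAll x Ps) ≤ N !
    without-last-point x =
      bollobás N (restrictAll x Ps) (DisjointPairs-restrictAll x disjoint) (CrossIntersecting-restrictAll x cross)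

central-binomial≤ : ∀ s → (s + s) ! ≤ (2 ^ s) ^ 2 * (s ! * s !)
central-binomial≤ zero = ≤-refl
central-binomial≤ (suc s) rewrite +-suc s s = begin
  suc (suc (s + s)) * (suc (s + s) * (s + s) !)    ≤⟨ *-monoʳ-≤ (suc (suc (s + s))) (*-mono-≤ (n≤1+n (suc (s + s))) (central-binomial≤ s)) ⟩
  suc (suc (s + s)) * (suc (suc (s + s)) * bound)  ≡⟨ double (2 ^ s) s (s !) ⟩
  (2 * 2 ^ s) ^ 2 * (suc s * s ! * (suc s * s !))  ∎
  where
  open ≤-Reasoning
  bound : ℕ
  bound = (2 ^ s) ^ 2 * (s ! * s !)
  double : ∀ p s f → (2 + (s + s)) * ((2 + (s + s)) * (p * (p * 1) * (f * f)))
                  ≡ 2 * p * (2 * p * 1) * ((1 + s) * f * ((1 + s) * f))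
  double = solve-∀

bollobás-uniform : ∀ N r (Ps : List (SetPair N)) → DisjointPairs Ps → CrossIntersecting Ps →
                   All (λ p → ∣ proj₁ p ∣ ≡ r × ∣ proj₂ p ∣ ≡ r) Ps → length Ps ≤ (2 ^ r) ^ 2
bollobás-uniform N r [] _ _ _ = z≤n
bollobás-uniform N r Ps@((A , B) ∷ _) disjoint@(A#B ∷ _) cross sizes@((∣A∣≡r , ∣B∣≡r) ∷ _) =
  *-cancelʳ-≤ _ _ (r ! * r !) {{r !* r !≢0}} (*-cancelʳ-≤ _ _ (N !) {{N !≢0}} (begin
    length Ps * (r ! * r !) * N !                ≡⟨ regroup (length Ps) (r !) (N !) ⟩
    length Ps * (N ! * r ! * r !)                ≡⟨ cong (length Ps *_) (beforeCount-closed N r r r+r≤N) ⟨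
    length Ps * (beforeCount N r r * (r + r) !)  ≡⟨ *-assoc (length Ps) (beforeCount N r r) ((r + r) !) ⟨
    length Ps * beforeCount N r r * (r + r) !    ≤⟨ *-monoˡ-≤ ((r + r) !) count≤ ⟩
    N ! * (r + r) !                              ≤⟨ *-monoʳ-≤ (N !) (central-binomial≤ r) ⟩
    N ! * ((2 ^ r) ^ 2 * (r ! * r !))            ≡⟨ *-comm (N !) _ ⟩
    (2 ^ r) ^ 2 * (r ! * r !) * N !              ∎))
  where
  open ≤-Reasoning
  r+r≤N : r + r ≤ N
  r+r≤N = subst (_≤ N) (cong₂ _+_ ∣A∣≡r ∣B∣≡r) (disjointᵇ⇒∣∣+∣∣≤ A B A#B)
  count≤ : length Ps * beforeCount N r r ≤ N !
  count≤ = begin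
    length Ps * beforeCount N r r  ≡⟨ ∑ˡ-const (beforeCount N r r) Ps ⟨
    ∑[ p ∈ Ps ] beforeCount N r r  ≡⟨ ∑ˡ-cong (All.map (λ (∣A∣≡r , ∣B∣≡r) → cong₂ (beforeCount N) ∣A∣≡r ∣B∣≡r) sizes) ⟨
    ∑ˡ weight Ps                   ≤⟨ bollobás N Ps disjoint cross ⟩
    N !                            ∎
  regroup : ∀ s f n → s * (f * f) * n ≡ s * (n * f * f)
  regroup = solve-∀

keepAlso : A → A × List A → A × List A
keepAlso y (x , rest) = x , y ∷ rest

pickOne : List A → List (A × List A)
pickOne [] = []
pickOne (y ∷ ys) = (y , ys) ∷ map (keepAlso y) (pickOne ys)

length-pickOne : length (pickOne xs) ≡ length xs
length-pickOne {xs = []} = refl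
length-pickOne {xs = y ∷ ys} = cong suc (trans (length-map _ (pickOne ys)) (length-pickOne {xs = ys}))

pickOne-∈ : ∀ {x rest} → (x , rest) ∈ pickOne xs → x ∈ xs
pickOne-∈ {xs = y ∷ ys} (here refl) = here refl
pickOne-∈ {xs = y ∷ ys} (there p∈) with ∈-map⁻ _ p∈
... | _ , q∈ , refl = there (pickOne-∈ q∈)

pickOne-⊆ : ∀ {x rest z} → (x , rest) ∈ pickOne xs → z ∈ rest → z ∈ xs
pickOne-⊆ {xs = y ∷ ys} (here refl) z∈ = there z∈
pickOne-⊆ {xs = y ∷ ys} (there p∈) z∈ with ∈-map⁻ _ p∈
pickOne-⊆ {xs = y ∷ ys} (there p∈) (here refl) | _ , q∈ , refl = here refl
pickOne-⊆ {xs = y ∷ ys} (there p∈) (there z∈) | _ , q∈ , refl = there (pickOne-⊆ q∈ z∈)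

pickOne-length : ∀ {x rest} → (x , rest) ∈ pickOne xs → suc (length rest) ≡ length xs
pickOne-length {xs = y ∷ ys} (here refl) = refl
pickOne-length {xs = y ∷ ys} (there p∈) with ∈-map⁻ _ p∈
... | _ , q∈ , refl = cong suc (pickOne-length q∈)

pickOne-AllPairs : ∀ {R : A → A → Set} {x rest} → AllPairs R xs → (x , rest) ∈ pickOne xs → AllPairs R rest
pickOne-AllPairs {xs = y ∷ ys} (_ ∷ ys-pairs) (here refl) = ys-pairs
pickOne-AllPairs {xs = y ∷ ys} (y-all ∷ ys-pairs) (there p∈) with ∈-map⁻ _ p∈
... | _ , q∈ , refl = All.tabulate (λ z∈ → All.lookup y-all (pickOne-⊆ q∈ z∈)) ∷ pickOne-AllPairs ys-pairs q∈

justs : ∀ {n} → (Fin n → Maybe A) → List A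
justs {n = zero} f = []
justs {n = suc n} f with f zero
... | just a = a ∷ justs (f ∘ suc)
... | nothing = justs (f ∘ suc)

length-justs : ∀ {n} (f : Fin n → Maybe A) → length (justs f) ≡ ∑[ i < n ] bit (is-just (f i))
length-justs {n = zero} f = refl
length-justs {n = suc n} f with f zero
... | just a = cong suc (length-justs (f ∘ suc))
... | nothing = length-justs (f ∘ suc)

All-justs : ∀ {n} {P : A → Set} (f : Fin n → Maybe A) → (∀ i {a} → f i ≡ just a → P a) → All P (justs f)
All-justs {n = zero} f P-f = []
All-justs {n = suc n} f P-f with f zero in f0≡
... | just a = P-f zero f0≡ ∷ All-justs (f ∘ suc) (P-f ∘ suc)
... | nothing = All-justs (f ∘ suc) (P-f ∘ suc)

AllPairs-justs : ∀ {n} {R : A → A → Set} (f : Fin n → Maybe A) →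
                 (∀ {i j} → i ≢ j → ∀ {a b} → f i ≡ just a → f j ≡ just b → R a b) → AllPairs R (justs f)
AllPairs-justs {n = zero} f R-f = []
AllPairs-justs {n = suc n} f R-f with f zero in f0≡
... | just a = All-justs (f ∘ suc) (λ i → R-f (λ ()) f0≡) ∷ AllPairs-justs (f ∘ suc) (λ i≢j → R-f (i≢j ∘ Fin.suc-injective))
... | nothing = AllPairs-justs (f ∘ suc) (λ i≢j → R-f (i≢j ∘ Fin.suc-injective))

firstTwo : List A → Maybe (A × A)
firstTwo (a ∷ b ∷ _) = just (a , b)
firstTwo _ = nothing

firstTwo-just : ∀ (xs : List A) {a b} → firstTwo xs ≡ just (a , b) → Σ (List A) λ rest → xs ≡ a ∷ b ∷ rest
firstTwo-just (a ∷ b ∷ rest) refl = rest , refl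

length≤1+firstTwo : ∀ r (xs : List A) → length xs ≤ r → length xs ≤ 1 + (r ∸ 1) * bit (is-just (firstTwo xs))
length≤1+firstTwo r [] _ = z≤n
length≤1+firstTwo r (a ∷ []) _ = s≤s z≤n
length≤1+firstTwo (suc r) (a ∷ b ∷ xs) length≤r = ≤-trans length≤r (≤-reflexive (cong suc (sym (*-identityʳ r))))

length-filter-≡true : ∀ (f : A → Bool) xs → length (filter (λ x → f x Bool.≟ true) xs) ≡ ∑[ x ∈ xs ] bit (f x)
length-filter-≡true f [] = refl
length-filter-≡true f (x ∷ xs) with f x
... | true = cong suc (length-filter-≡true f xs)
... | false = length-filter-≡true f xs

2≤n+bit[n≡ᵇ1] : ∀ {n} → 1 ≤ n → 2 ≤ n + bit (n ≡ᵇ 1)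
2≤n+bit[n≡ᵇ1] {1} _ = ≤-refl
2≤n+bit[n≡ᵇ1] {suc (suc n)} _ = s≤s (s≤s z≤n)

≤2*⌈/2⌉ : ∀ a → a ≤ 2 * ⌈ a /2⌉
≤2*⌈/2⌉ a = ≤-pred (begin
  suc a                          ≡⟨ +-comm 1 a ⟩
  a + 1                          ≡⟨ m≡m%n+[m/n]*n (a + 1) 2 ⟩
  (a + 1) % 2 + (a + 1) / 2 * 2  ≤⟨ +-monoˡ-≤ _ (≤-pred (m%n<n (a + 1) 2)) ⟩
  1 + (a + 1) / 2 * 2            ≡⟨ cong suc (*-comm ((a + 1) / 2) 2) ⟩
  suc (2 * ⌈ a /2⌉)              ∎)
  where open ≤-Reasoning

counts⇒k*[r+1]*[n∸m]≤ : ∀ n m k r Q S → m ≤ n → k * ((r + 1) * n) ≤ k * (r * m) + S → S ≤ m * (k + (r ∸ 1) * Q) →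
                       k * (r + 1) * (n ∸ m) ≤ m * (r ∸ 1) * Q
counts⇒k*[r+1]*[n∸m]≤ n m k r Q S m≤n lower upper = +-cancelˡ-≤ (k * (r * m) + k * m) _ _ (begin
  k * (r * m) + k * m + k * (r + 1) * (n ∸ m)  ≡⟨ regroup-lower k r m (n ∸ m) ⟩
  k * ((r + 1) * (m + (n ∸ m)))                ≡⟨ cong (λ t → k * ((r + 1) * t)) (m+[n∸m]≡n m≤n) ⟩
  k * ((r + 1) * n)                            ≤⟨ lower ⟩
  k * (r * m) + S                              ≤⟨ +-monoʳ-≤ (k * (r * m)) upper ⟩
  k * (r * m) + m * (k + (r ∸ 1) * Q)          ≡⟨ regroup-upper k r m (r ∸ 1) Q ⟩
  k * (r * m) + k * m + m * (r ∸ 1) * Q        ∎)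
  where
  open ≤-Reasoning
  regroup-lower : ∀ k r m d → k * (r * m) + k * m + k * (r + 1) * d ≡ k * ((r + 1) * (m + d))
  regroup-lower = solve-∀
  regroup-upper : ∀ k r m s Q → k * (r * m) + m * (k + s * Q) ≡ k * (r * m) + k * m + m * s * Q
  regroup-upper = solve-∀

square-deficit≤ : ∀ n m k r Q S → n ≤ k + m → k * ((r + 1) * n) ≤ k * (r * m) + S → S ≤ m * (k + (r ∸ 1) * Q) →
                  (n ∸ m) ^ 2 ≤ Q * n
square-deficit≤ n m k r Q S n≤k+m lower upper with n ≤? m
... | yes n≤m rewrite m≤n⇒m∸n≡0 n≤m = z≤n
... | no n≰m = *-cancelˡ-≤ (r + 1) {{>-nonZero (m≤n+m 1 r)}} (begin
  (r + 1) * d ^ 2          ≡⟨ reorder-left r d ⟩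
  d * (r + 1) * d          ≤⟨ *-monoˡ-≤ d (*-monoˡ-≤ (r + 1) d≤k) ⟩
  k * (r + 1) * d          ≤⟨ counts⇒k*[r+1]*[n∸m]≤ n m k r Q S m≤n lower upper ⟩
  m * (r ∸ 1) * Q          ≤⟨ *-monoˡ-≤ Q (*-mono-≤ m≤n (≤-trans (m∸n≤m r 1) (m≤m+n r 1))) ⟩
  n * (r + 1) * Q          ≡⟨ reorder-right n r Q ⟩
  (r + 1) * (Q * n)        ∎)
  where
  open ≤-Reasoning
  d : ℕ
  d = n ∸ m
  m≤n : m ≤ n
  m≤n = <⇒≤ (≰⇒> n≰m)
  d≤k : d ≤ k
  d≤k = +-cancelʳ-≤ m d k (subst (_≤ k + m) (sym (trans (+-comm d m) (m+[n∸m]≡n m≤n))) n≤k+m)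
  reorder-left : ∀ r d → (r + 1) * (d * (d * 1)) ≡ d * (r + 1) * d
  reorder-left = solve-∀
  reorder-right : ∀ n r Q → n * (r + 1) * Q ≡ (r + 1) * (Q * n)
  reorder-right = solve-∀

one-fewer-missing : ∀ {n m m′ d} → n ∸ m ≡ suc d → m′ ≡ suc m → n ∸ m′ ≡ d
one-fewer-missing {n} {m} n∸m≡ refl = trans (sym (pred[m∸n]≡m∸[1+n] n m)) (cong pred n∸m≡)

unusedᵇ : ∀ {n} → Fin n → List (Fin n × A) → Bool
unusedᵇ c = all (λ x → not (does (c ≟ proj₁ x)))

unusedᵇ⇒≢ : ∀ {n} {c : Fin n} (R : List (Fin n × A)) {x} → unusedᵇ c R ≡ true → x ∈ R → c ≢ proj₁ x
unusedᵇ⇒≢ {c = c} (y ∷ R) unused x∈ with c ≟ proj₁ y | x∈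
... | no c≢y | here refl = c≢y
... | no _ | there x∈R = unusedᵇ⇒≢ R unused x∈R

∑-bit-≟ : ∀ {n} (d : Fin n) → ∑[ c < n ] bit (does (c ≟ d)) ≡ 1
∑-bit-≟ {suc n} zero = cong suc (trans (∑-const n 0) (*-zeroʳ n))
∑-bit-≟ {suc n} (suc d) = ∑-bit-≟ d

n≤∑unusedᵇ+length : ∀ {n} (R : List (Fin n × A)) → n ≤ ∑[ c < n ] bit (unusedᵇ c R) + length R
n≤∑unusedᵇ+length {n = n} R = begin
  n                                                         ≡⟨ trans (∑-const n 1) (*-identityʳ n) ⟨
  ∑[ c < n ] 1                                              ≤⟨ ∑-mono-≤ (λ c → unused-or-used c R) ⟩
  ∑[ c < n ] (bit (unusedᵇ c R) + usedAt c)                 ≡⟨ ∑-distrib-+ (λ c → bit (unusedᵇ c R)) usedAt ⟩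
  #unused + ∑[ c < n ] usedAt c                             ≡⟨ cong (#unused +_) (∑-∑ˡ-comm (λ c x → bit (does (c ≟ proj₁ x))) R) ⟩
  #unused + ∑[ x ∈ R ] ∑[ c < n ] bit (does (c ≟ proj₁ x))  ≡⟨ cong (#unused +_) (∑ˡ-cong (All.universal (λ x → ∑-bit-≟ (proj₁ x)) R)) ⟩
  #unused + ∑[ x ∈ R ] 1                                    ≡⟨ cong (#unused +_) (trans (∑ˡ-const 1 R) (*-identityʳ _)) ⟩
  #unused + length R                                        ∎
  where
  open ≤-Reasoning
  #unused : ℕ
  #unused = ∑[ c < n ] bit (unusedᵇ c R)
  usedAt : Fin n → ℕ
  usedAt c = ∑[ x ∈ R ] bit (does (c ≟ proj₁ x))
  unused-or-used : ∀ c R → 1 ≤ bit (unusedᵇ c R) + ∑[ x ∈ R ] bit (does (c ≟ proj₁ x))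
  unused-or-used c [] = s≤s z≤n
  unused-or-used c (x ∷ R) with does (c ≟ proj₁ x)
  ... | true = s≤s z≤n
  ... | false = unused-or-used c R

freeFromᵇ : Subset k → List (A × Subset k) → Bool
freeFromᵇ g = all (λ x → disjointᵇ g (proj₂ x))

meetCount : Subset k → List (A × Subset k) → ℕ
meetCount g R = ∑[ x ∈ R ] bit (meetsᵇ g (proj₂ x))

pendantᵇ : Subset k → (A × Subset k) × List (A × Subset k) → Bool
pendantᵇ g (e , rest) = meetsᵇ g (proj₂ e) ∧ freeFromᵇ g rest

module _ (g : Subset k) where

  freeFromᵇ-∈ : ∀ {R : List (A × Subset k)} {x} → freeFromᵇ g R ≡ true → x ∈ R → disjointᵇ g (proj₂ x) ≡ true
  freeFromᵇ-∈ free (here refl) = proj₁ (∧≡true free)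
  freeFromᵇ-∈ free (there x∈) = freeFromᵇ-∈ (proj₂ (∧≡true free)) x∈

  freeFromᵇ≡meetCount≡ᵇ0 : ∀ (R : List (A × Subset k)) → freeFromᵇ g R ≡ (meetCount g R ≡ᵇ 0)
  freeFromᵇ≡meetCount≡ᵇ0 [] = refl
  freeFromᵇ≡meetCount≡ᵇ0 (x ∷ R) with disjointᵇ g (proj₂ x)
  ... | true = freeFromᵇ≡meetCount≡ᵇ0 R
  ... | false = refl

  1≤meetCount : ∀ (R : List (A × Subset k)) → freeFromᵇ g R ≡ false → 1 ≤ meetCount g R
  1≤meetCount (x ∷ R) met with disjointᵇ g (proj₂ x)
  ... | true = 1≤meetCount R met
  ... | false = s≤s z≤n

  ∑-pendantᵇ : ∀ (R : List (A × Subset k)) → ∑[ p ∈ pickOne R ] bit (pendantᵇ g p) ≡ bit (meetCount g R ≡ᵇ 1)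
  ∑-pendantᵇ [] = refl
  ∑-pendantᵇ (y ∷ R) = trans (cong (bit (pendantᵇ g (y , R)) +_) (∑ˡ-map (bit ∘ pendantᵇ g) (keepAlso y) (pickOne R))) by-y
    where
    open ≡-Reasoning
    by-y : bit (pendantᵇ g (y , R)) + ∑[ p ∈ pickOne R ] bit (pendantᵇ g (keepAlso y p)) ≡ bit (meetCount g (y ∷ R) ≡ᵇ 1)
    by-y with disjointᵇ g (proj₂ y)
    ... | true = ∑-pendantᵇ R
    ... | false = begin
      bit (freeFromᵇ g R) + ∑[ p ∈ pickOne R ] bit (meetsᵇ g (proj₂ (proj₁ p)) ∧ false)
        ≡⟨ cong₂ _+_ (cong bit (freeFromᵇ≡meetCount≡ᵇ0 R)) (∑ˡ-cong (All.universal (λ p → cong bit (∧-zeroʳ (meetsᵇ g (proj₂ (proj₁ p))))) (pickOne R))) ⟩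
      bit (meetCount g R ≡ᵇ 0) + ∑[ p ∈ pickOne R ] 0
        ≡⟨ cong (bit (meetCount g R ≡ᵇ 0) +_) (trans (∑ˡ-const 0 (pickOne R)) (*-zeroʳ (length (pickOne R)))) ⟩
      bit (meetCount g R ≡ᵇ 0) + 0
        ≡⟨ +-identityʳ _ ⟩
      bit (meetCount g R ≡ᵇ 0) ∎

∑-meetCount≤ : ∀ {L : List (Subset k)} (R : List (A × Subset k)) → AllPairs (λ g h → disjointᵇ g h ≡ true) L →
               ∑[ g ∈ L ] meetCount g R ≤ ∑[ x ∈ R ] ∣ proj₂ x ∣
∑-meetCount≤ {L = L} R L-disjoint = begin
  ∑[ g ∈ L ] ∑[ x ∈ R ] bit (meetsᵇ g (proj₂ x))  ≡⟨ ∑ˡ-comm (λ g x → bit (meetsᵇ g (proj₂ x))) L R ⟩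
  ∑[ x ∈ R ] ∑[ g ∈ L ] bit (meetsᵇ g (proj₂ x))  ≤⟨ ∑ˡ-mono-≤ (All.universal (λ x → ∑-meetsᵇ≤∣∣ (proj₂ x) L-disjoint) R) ⟩
  ∑[ x ∈ R ] ∣ proj₂ x ∣                          ∎
  where open ≤-Reasoning

-- Growing a rainbow matching

module Greedy {r n N : ℕ} (Ms : Fin n → List (Edge N)) (Ms-matching : ∀ i → IsMatching r (Ms i))
              (Ms-size : ∀ i → length (Ms i) ≡ ⌈ (r + 1) * n /2⌉) where

  ColouredEdge : Set
  ColouredEdge = Fin n × Edge N

  RainbowList : List ColouredEdge → Set
  RainbowList R = All (λ x → proj₂ x ∈ Ms (proj₁ x)) R ×
                  AllPairs (λ x y → disjointᵇ (proj₂ x) (proj₂ y) ≡ true × proj₁ x ≢ proj₁ y) R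

  ∣∣≡r : ∀ {i g} → g ∈ Ms i → ∣ g ∣ ≡ r
  ∣∣≡r {i} = All.lookup (proj₁ (Ms-matching i))

  Ms-disjointᵇ : ∀ i → AllPairs (λ g h → disjointᵇ g h ≡ true) (Ms i)
  Ms-disjointᵇ i = AllPairs.map (Disjoint⇒disjointᵇ _ _) (proj₂ (Ms-matching i))

  Extension : List ColouredEdge → Set
  Extension R = Σ (Fin n) λ i → unusedᵇ i R ≡ true × Any (λ g → freeFromᵇ g R ≡ true) (Ms i)

  Exchange : List ColouredEdge → Set
  Exchange R = Any (λ p → Σ (Fin n) λ i → Σ (Fin n) λ j → i ≢ j × unusedᵇ i R ≡ true × unusedᵇ j R ≡ true ×
                 Any (λ g → freeFromᵇ g (proj₂ p) ≡ true ×
                   Any (λ h → freeFromᵇ h (proj₂ p) ≡ true × disjointᵇ g h ≡ true) (Ms j)) (Ms i)) (pickOne R)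

  extension? : ∀ R → Dec (Extension R)
  extension? R = Fin.any? λ i → (unusedᵇ i R Bool.≟ true) ×-dec Any.any? (λ g → freeFromᵇ g R Bool.≟ true) (Ms i)

  exchange? : ∀ R → Dec (Exchange R)
  exchange? R = Any.any? (λ p → Fin.any? λ i → Fin.any? λ j →
    ¬? (i ≟ j) ×-dec (unusedᵇ i R Bool.≟ true) ×-dec (unusedᵇ j R Bool.≟ true) ×-dec
    Any.any? (λ g → (freeFromᵇ g (proj₂ p) Bool.≟ true) ×-dec
      Any.any? (λ h → (freeFromᵇ h (proj₂ p) Bool.≟ true) ×-dec (disjointᵇ g h Bool.≟ true)) (Ms j)) (Ms i)) (pickOne R)

  Larger : List ColouredEdge → Set
  Larger R = Σ (List ColouredEdge) λ R′ → RainbowList R′ × length R′ ≡ suc (length R)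

  extend : ∀ {R} → RainbowList R → Extension R → Larger R
  extend {R} (R-in , R-pairs) (i , i-unused , g-any) =
    let g , g∈ , g-free = find g-any in
    (i , g) ∷ R ,
    (g∈ ∷ R-in , All.tabulate (λ x∈ → freeFromᵇ-∈ g g-free x∈ , unusedᵇ⇒≢ R i-unused x∈) ∷ R-pairs) ,
    refl

  exchange : ∀ {R} → RainbowList R → Exchange R → Larger R
  exchange {R} (R-in , R-pairs) p-any =
    let (_ , rest) , p∈ , i , j , i≢j , i-unused , j-unused , g-any = find p-any
        g , g∈ , g-free , h-any = find g-any
        h , h∈ , h-free , g#h = find h-any
    in
    (i , g) ∷ (j , h) ∷ rest ,
    (g∈ ∷ h∈ ∷ All.tabulate (λ z∈ → All.lookup R-in (pickOne-⊆ p∈ z∈)) ,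
     ((g#h , i≢j) ∷ All.tabulate (λ z∈ → freeFromᵇ-∈ g g-free z∈ , unusedᵇ⇒≢ R i-unused (pickOne-⊆ p∈ z∈)))
     ∷ All.tabulate (λ z∈ → freeFromᵇ-∈ h h-free z∈ , unusedᵇ⇒≢ R j-unused (pickOne-⊆ p∈ z∈))
     ∷ pickOne-AllPairs R-pairs p∈) ,
    cong suc (pickOne-length p∈)

  module Stuck {R : List ColouredEdge} (R-rainbow : RainbowList R) (no-extension : ¬ Extension R) (no-exchange : ¬ Exchange R) where

    m : ℕ
    m = length R

    unused : Fin n → ℕ
    unused c = bit (unusedᵇ c R)

    #unused : ℕ
    #unused = ∑[ c < n ] unused c

    #pendantPicks : Edge N → ℕ
    #pendantPicks g = ∑[ p ∈ pickOne R ] bit (pendantᵇ g p)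

    #pendants : ℕ
    #pendants = ∑[ c < n ] (unused c * ∑[ g ∈ Ms c ] #pendantPicks g)

    #pendantsAt : ColouredEdge × List ColouredEdge → Fin n → ℕ
    #pendantsAt p c = ∑[ g ∈ Ms c ] bit (pendantᵇ g p)

    ∑-meetCount-Ms≤ : ∀ c → ∑[ g ∈ Ms c ] meetCount g R ≤ m * r
    ∑-meetCount-Ms≤ c = ≤-trans (∑-meetCount≤ R (Ms-disjointᵇ c))
                                 (≤-reflexive (trans (∑ˡ-cong (All.map ∣∣≡r (proj₁ R-rainbow))) (∑ˡ-const r R)))

    per-unused : ∀ c → unusedᵇ c R ≡ true → (r + 1) * n ≤ m * r + ∑[ g ∈ Ms c ] #pendantPicks g
    per-unused c c-unused = begin
      (r + 1) * n                                                  ≤⟨ ≤2*⌈/2⌉ ((r + 1) * n) ⟩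
      2 * ⌈ (r + 1) * n /2⌉                                        ≡⟨ cong (2 *_) (Ms-size c) ⟨
      2 * length (Ms c)                                            ≡⟨ trans (∑ˡ-const 2 (Ms c)) (*-comm (length (Ms c)) 2) ⟨
      ∑[ g ∈ Ms c ] 2                                              ≤⟨ ∑ˡ-mono-≤ (All.tabulate meets-twice) ⟩
      ∑[ g ∈ Ms c ] (meetCount g R + #pendantPicks g)              ≡⟨ ∑ˡ-distrib-+ (Ms c) ⟩
      ∑[ g ∈ Ms c ] meetCount g R + ∑[ g ∈ Ms c ] #pendantPicks g  ≤⟨ +-monoˡ-≤ _ (∑-meetCount-Ms≤ c) ⟩
      m * r + ∑[ g ∈ Ms c ] #pendantPicks g                        ∎
      where
      open ≤-Reasoning
      meets-twice : ∀ {g} → g ∈ Ms c → 2 ≤ meetCount g R + #pendantPicks g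
      meets-twice {g} g∈ = subst (λ t → 2 ≤ meetCount g R + t) (sym (∑-pendantᵇ g R))
        (2≤n+bit[n≡ᵇ1] (1≤meetCount g R (¬-not λ g-free → no-extension (c , c-unused , lose g∈ g-free))))

    lower : #unused * ((r + 1) * n) ≤ #unused * (r * m) + #pendants
    lower = begin
      #unused * ((r + 1) * n)                                                     ≡⟨ ∑-*ʳ ((r + 1) * n) unused ⟨
      ∑[ c < n ] (unused c * ((r + 1) * n))                                       ≤⟨ ∑-mono-≤ per-colour ⟩
      ∑[ c < n ] (unused c * (r * m) + unused c * ∑[ g ∈ Ms c ] #pendantPicks g)  ≡⟨ ∑-distrib-+ (λ c → unused c * (r * m)) _ ⟩
      ∑[ c < n ] (unused c * (r * m)) + #pendants                                 ≡⟨ cong (_+ #pendants) (∑-*ʳ (r * m) unused) ⟩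
      #unused * (r * m) + #pendants                                               ∎
      where
      open ≤-Reasoning
      per-colour : ∀ c → unused c * ((r + 1) * n) ≤ unused c * (r * m) + unused c * ∑[ g ∈ Ms c ] #pendantPicks g
      per-colour c with unusedᵇ c R in c-unused
      ... | false = z≤n
      ... | true rewrite *-identityˡ ((r + 1) * n) | *-identityˡ (r * m) | *-identityˡ (∑[ g ∈ Ms c ] #pendantPicks g)
                       | *-comm r m = per-unused c c-unused

    module AtPick {e rest} (p∈ : (e , rest) ∈ pickOne R) where

      pendantsAt : Fin n → List (Edge N)
      pendantsAt c = filter (λ g → pendantᵇ g (e , rest) Bool.≟ true) (Ms c)

      pair : Fin n → Maybe (Edge N × Edge N)
      pair c = if unusedᵇ c R then firstTwo (pendantsAt c) else nothing

      record PendantPair (c : Fin n) (g h : Edge N) : Set where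
        field
          c-unused : unusedᵇ c R ≡ true
          g∈ : g ∈ Ms c
          g-pendant : pendantᵇ g (e , rest) ≡ true
          h∈ : h ∈ Ms c
          h-pendant : pendantᵇ h (e , rest) ≡ true
          g#h : disjointᵇ g h ≡ true

      pair-spec : ∀ c {g h} → pair c ≡ just (g , h) → PendantPair c g h
      pair-spec c {g} {h} pair≡ with unusedᵇ c R in c-unused
      ... | true with firstTwo-just (pendantsAt c) pair≡
      ...   | _ , pendantsAt≡ = record
        { c-unused = c-unused
        ; g∈ = proj₁ g-spec ; g-pendant = proj₂ g-spec
        ; h∈ = proj₁ h-spec ; h-pendant = proj₂ h-spec
        ; g#h = head-disjoint (subst (AllPairs _) pendantsAt≡ (AllPairs.filter⁺ _ (Ms-disjointᵇ c)))
        }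
        where
        g-spec : g ∈ Ms c × pendantᵇ g (e , rest) ≡ true
        h-spec : h ∈ Ms c × pendantᵇ h (e , rest) ≡ true
        g-spec = ∈-filter⁻ (λ g → pendantᵇ g (e , rest) Bool.≟ true) (subst (_ ∈_) (sym pendantsAt≡) (here refl))
        h-spec = ∈-filter⁻ (λ g → pendantᵇ g (e , rest) Bool.≟ true) (subst (_ ∈_) (sym pendantsAt≡) (there (here refl)))
        head-disjoint : ∀ {g h rest′} → AllPairs (λ g h → disjointᵇ g h ≡ true) (g ∷ h ∷ rest′) → disjointᵇ g h ≡ true
        head-disjoint ((g#h ∷ _) ∷ _) = g#h

      -- Otherwise e could be exchanged for g and h′.
      crossing : ∀ {c c′ g h g′ h′} → c ≢ c′ → PendantPair c g h → PendantPair c′ g′ h′ → disjointᵇ g h′ ≡ false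
      crossing {c} {c′} c≢c′ P P′ = ¬-not λ g#h′ → no-exchange (lose p∈
        (c , c′ , c≢c′ , c-unused P , c-unused P′ ,
         lose (g∈ P) (proj₂ (∧≡true (g-pendant P)) , lose (h∈ P′) (proj₂ (∧≡true (h-pendant P′)) , g#h′))))
        where open PendantPair

      #pairs≤ : length (justs pair) ≤ (2 ^ r) ^ 2
      #pairs≤ = bollobás-uniform N r (justs pair)
        (All-justs pair λ c eq → PendantPair.g#h (pair-spec c eq))
        (AllPairs-justs pair λ c≢c′ eq eq′ →
          crossing c≢c′ (pair-spec _ eq) (pair-spec _ eq′) , crossing (c≢c′ ∘ sym) (pair-spec _ eq′) (pair-spec _ eq))
        (All-justs pair λ c eq → ∣∣≡r (PendantPair.g∈ (pair-spec c eq)) , ∣∣≡r (PendantPair.h∈ (pair-spec c eq)))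

      #pendantsAt≤r : ∀ c → #pendantsAt (e , rest) c ≤ r
      #pendantsAt≤r c = begin
        #pendantsAt (e , rest) c                ≤⟨ ∑ˡ-mono-≤ (All.universal (λ g → bit-∧≤ _ _) (Ms c)) ⟩
        ∑[ g ∈ Ms c ] bit (meetsᵇ g (proj₂ e))  ≤⟨ ∑-meetsᵇ≤∣∣ (proj₂ e) (Ms-disjointᵇ c) ⟩
        ∣ proj₂ e ∣                             ≡⟨ ∣∣≡r (All.lookup (proj₁ R-rainbow) (pickOne-∈ p∈)) ⟩
        r                                       ∎
        where open ≤-Reasoning

      per-colour : ∀ c → unused c * #pendantsAt (e , rest) c ≤ unused c + (r ∸ 1) * bit (is-just (pair c))
      per-colour c with unusedᵇ c R
      ... | false = z≤n
      ... | true = begin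
        1 * #pendantsAt (e , rest) c                           ≡⟨ *-identityˡ _ ⟩
        #pendantsAt (e , rest) c                               ≡⟨ length-filter-≡true (λ g → pendantᵇ g (e , rest)) (Ms c) ⟨
        length (pendantsAt c)                                  ≤⟨ length≤1+firstTwo r (pendantsAt c) length≤r ⟩
        1 + (r ∸ 1) * bit (is-just (firstTwo (pendantsAt c)))  ∎
        where
        open ≤-Reasoning
        length≤r : length (pendantsAt c) ≤ r
        length≤r = subst (_≤ r) (sym (length-filter-≡true _ (Ms c))) (#pendantsAt≤r c)

      per-pick : ∑[ c < n ] (unused c * #pendantsAt (e , rest) c) ≤ #unused + (r ∸ 1) * (2 ^ r) ^ 2
      per-pick = begin
        ∑[ c < n ] (unused c * #pendantsAt (e , rest) c)          ≤⟨ ∑-mono-≤ per-colour ⟩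
        ∑[ c < n ] (unused c + (r ∸ 1) * bit (is-just (pair c)))  ≡⟨ ∑-distrib-+ unused _ ⟩
        #unused + ∑[ c < n ] ((r ∸ 1) * bit (is-just (pair c)))   ≡⟨ cong (#unused +_) (∑-*ˡ (r ∸ 1) (bit ∘ is-just ∘ pair)) ⟩
        #unused + (r ∸ 1) * ∑[ c < n ] bit (is-just (pair c))     ≡⟨ cong (λ t → #unused + (r ∸ 1) * t) (length-justs pair) ⟨
        #unused + (r ∸ 1) * length (justs pair)                   ≤⟨ +-monoʳ-≤ #unused (*-monoʳ-≤ (r ∸ 1) #pairs≤) ⟩
        #unused + (r ∸ 1) * (2 ^ r) ^ 2                           ∎
        where open ≤-Reasoning

    upper : #pendants ≤ m * (#unused + (r ∸ 1) * (2 ^ r) ^ 2)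
    upper = begin
      ∑[ c < n ] (unused c * ∑[ g ∈ Ms c ] #pendantPicks g)
        ≡⟨ sum-cong-≗ (λ c → cong (unused c *_) (∑ˡ-comm (λ g p → bit (pendantᵇ g p)) (Ms c) (pickOne R))) ⟩
      ∑[ c < n ] (unused c * ∑[ p ∈ pickOne R ] #pendantsAt p c)
        ≡⟨ sum-cong-≗ (λ c → ∑ˡ-*ˡ (unused c) (λ p → #pendantsAt p c) (pickOne R)) ⟨
      ∑[ c < n ] ∑[ p ∈ pickOne R ] (unused c * #pendantsAt p c)
        ≡⟨ ∑-∑ˡ-comm (λ c p → unused c * #pendantsAt p c) (pickOne R) ⟩
      ∑[ p ∈ pickOne R ] ∑[ c < n ] (unused c * #pendantsAt p c)
        ≤⟨ ∑ˡ-mono-≤ (All.tabulate (λ p∈ → AtPick.per-pick p∈)) ⟩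
      ∑[ p ∈ pickOne R ] (#unused + (r ∸ 1) * (2 ^ r) ^ 2)
        ≡⟨ ∑ˡ-const _ (pickOne R) ⟩
      length (pickOne R) * (#unused + (r ∸ 1) * (2 ^ r) ^ 2)
        ≡⟨ cong (_* (#unused + (r ∸ 1) * (2 ^ r) ^ 2)) (length-pickOne {xs = R}) ⟩
      m * (#unused + (r ∸ 1) * (2 ^ r) ^ 2)
        ∎
      where open ≤-Reasoning

    deficit²≤ : (n ∸ m) ^ 2 ≤ (2 ^ r) ^ 2 * n
    deficit²≤ = square-deficit≤ n m #unused r ((2 ^ r) ^ 2) #pendants (n≤∑unusedᵇ+length R) lower upper

  augment : ∀ {R} → RainbowList R → Larger R ⊎ (¬ Extension R × ¬ Exchange R)
  augment {R} R-rainbow with extension? R | exchange? R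
  ... | yes ext | _ = inj₁ (extend R-rainbow ext)
  ... | no _ | yes exch = inj₁ (exchange R-rainbow exch)
  ... | no no-ext | no no-exch = inj₂ (no-ext , no-exch)

  grow : ∀ d R → RainbowList R → n ∸ length R ≡ d →
         Σ (List ColouredEdge) λ R′ → RainbowList R′ × (n ∸ length R′) ^ 2 ≤ (2 ^ r) ^ 2 * n
  grow zero R R-rainbow n∸m≡0 = R , R-rainbow , subst (λ t → t ^ 2 ≤ (2 ^ r) ^ 2 * n) (sym n∸m≡0) z≤n
  grow (suc d) R R-rainbow n∸m≡ with augment R-rainbow
  ... | inj₁ (R′ , R′-rainbow , m′≡) = grow d R′ R′-rainbow (one-fewer-missing n∸m≡ m′≡)
  ... | inj₂ (no-ext , no-exch) = R , R-rainbow , Stuck.deficit²≤ R-rainbow no-ext no-exch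

  colourOf : (R : List ColouredEdge) → Fin (length (map proj₂ R)) → Fin n
  colourOf (x ∷ R) zero = proj₁ x
  colourOf (x ∷ R) (suc i) = colourOf R i

  colourOf-≢ : ∀ {c} R → All (λ y → c ≢ proj₁ y) R → ∀ i → c ≢ colourOf R i
  colourOf-≢ (y ∷ R) (c≢y ∷ _) zero = c≢y
  colourOf-≢ (y ∷ R) (_ ∷ c≢R) (suc i) = colourOf-≢ R c≢R i

  colourOf-injective : ∀ R → AllPairs (λ x y → proj₁ x ≢ proj₁ y) R → Injective _≡_ _≡_ (colourOf R)
  colourOf-injective (x ∷ R) _ {zero} {zero} _ = refl
  colourOf-injective (x ∷ R) (x≢R ∷ _) {zero} {suc j} x≡ = ⊥-elim (colourOf-≢ R x≢R j x≡)
  colourOf-injective (x ∷ R) (x≢R ∷ _) {suc i} {zero} ≡x = ⊥-elim (colourOf-≢ R x≢R i (sym ≡x))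
  colourOf-injective (x ∷ R) (_ ∷ R-distinct) {suc i} {suc j} eq = cong suc (colourOf-injective R R-distinct eq)

  colourOf-∈ : ∀ R → All (λ x → proj₂ x ∈ Ms (proj₁ x)) R → ∀ i → List.lookup (map proj₂ R) i ∈ Ms (colourOf R i)
  colourOf-∈ (x ∷ R) (x∈ ∷ _) zero = x∈
  colourOf-∈ (x ∷ R) (_ ∷ R-in) (suc i) = colourOf-∈ R R-in i

  RainbowList⇒IsMatching : ∀ {R} → RainbowList R → IsMatching r (map proj₂ R)
  RainbowList⇒IsMatching (R-in , R-pairs) =
    All.map⁺ (All.map ∣∣≡r R-in) ,
    AllPairs.map⁺ (AllPairs.map (λ {x} {y} (x#y , _) → disjointᵇ⇒Disjoint (proj₂ x) (proj₂ y) x#y) R-pairs)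

  RainbowList⇒IsRainbow : ∀ {R} → RainbowList R → IsRainbow Ms (map proj₂ R)
  RainbowList⇒IsRainbow {R} (R-in , R-pairs) = colourOf R , colourOf-injective R (AllPairs.map proj₂ R-pairs) , colourOf-∈ R R-in

lemma2p6 : (r n N : ℕ) → r ≥ 3 → n ≥ 1 →
           (Ms : Fin n → List (Edge N)) →
           (∀ i → IsMatching r (Ms i)) →
           (∀ i → length (Ms i) ≡ ⌈ (r + 1) * n /2⌉) →
           Σ (List (Edge N)) λ M →
             IsMatching r M × IsRainbow Ms M ×
             (n ∸ length M) ^ 2 ≤ (2 ^ r) ^ 2 * n
lemma2p6 r n N _ _ Ms Ms-matching Ms-size =
  let open Greedy Ms Ms-matching Ms-size
      R , R-rainbow , deficit²≤ = grow n [] ([] , []) refl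
  in map proj₂ R , RainbowList⇒IsMatching R-rainbow , RainbowList⇒IsRainbow R-rainbow ,
     subst (λ t → (n ∸ t) ^ 2 ≤ (2 ^ r) ^ 2 * n) (sym (length-map proj₂ R)) deficit²≤
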